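{- For every $n\ge1$, the dual labeling $\lambda_\bullet^*$ is an EL-labeling of the order dual $(\Pi_n^\bullet)^*$. Consequently the maximal intervals of the order dual are EL-shellable.
   Context: A pointed set is a pair $(A,p)$, written $A^p$, with $A$ nonempty finite and $p\in A$. A pointed partition of $[n]$ is a collection of pointed sets whose underlying sets form a set partition of $[n]$. In $\Pi_n^\bullet$, $\pi\lessdot\pi'$ exactly when $\pi'$ is obtained from $\pi$ by replacing two blocks $A^p,B^q$ (with $\min A<\min B$) by $(A\cup B)^p$ (a $1$-merge) or $(A\cup B)^q$ (a $0$-merge), other blocks unchanged. The labeling $\lambda_\bullet$ assigns to a $u$-merge the label $(\min A,\min B)^u$, valued in the poset $\Lambda_n^\bullet$ with elements $(a,b)^u$ ($1\le a<b\le n$, $u\in\{0,1\}$), ordered as the ordinal sum $A_1\oplus C_1\oplus\cdots\oplus A_{n-1}\oplus C_{n-1}$, where $A_a$ is the antichain $\{(a,b)^0\}$ and $C_a$ the chain $\{(a,b)^1\}$ with $(a,b)^1<(a,c)^1$ iff $b<c$. For a poset $P$ with edge labeling $\lambda:\mathcal{E}(P)\to\Lambda$, the order dual $P^*$ has reversed order, and the dual labeling $\lambda^*:\mathcal{E}(P^*)\to\Lambda^*$ is $\lambda^*(y\lessdot_{P^*}x)=\lambda(x\lessdot_P y)$, where $\Lambda^*$ is the order dual of $\Lambda$. An edge labeling is an EL-labeling if every closed interval has a unique increasing maximal chain (consecutive labels strictly increasing) whose label sequence lexicographically precedes that of every other maximal chain of the interval. -}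

module Defs where

open import Data.Nat using (ℕ; zero; suc; _≤_)
open import Data.Fin using (Fin; _<_; _≤_; _≟_)
open import Data.Fin.Base using (toℕ)
open import Data.Vec using (Vec; lookup; tabulate)
open import Data.List using (List; []; _∷_; map)
open import Data.Bool.ListAction using (and)
open import Data.List.Base using (allFin)
open import Data.Bool using (Bool; true; false; T; if_then_else_; _∨_)
open import Data.Product using (Σ; _×_; _,_; proj₁)
open import Data.Sum using (_⊎_)
open import Relation.Nullary using (¬_)
open import Relation.Nullary.Decidable using (⌊_⌋)
open import Relation.Binary.PropositionalEquality using (_≡_; _≢_)

-- A finite poset is given by its
-- cover relation _⋖_; its order is the reflexive-transitive closure,
-- so x ≤ y iff there is a (saturated = maximal) chain from x to y, and
-- the maximal chains of the closed interval [x,y] are exactly the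
-- cover-chains from x to y.

module ELTheory {E L : Set} (_⋖_ : E → E → Set)
                (label : ∀ {x y} → x ⋖ y → L)
                (_<L_ : L → L → Set) where

  data Chain : E → E → Set where
    []  : ∀ {x} → Chain x x
    _∷_ : ∀ {x y z} → x ⋖ y → Chain y z → Chain x z

  verts : ∀ {x y} → Chain x y → List E
  verts {x} []      = x ∷ []
  verts {x} (_ ∷ c) = x ∷ verts c

  labels : ∀ {x y} → Chain x y → List L
  labels []      = []
  labels (e ∷ c) = label e ∷ labels c

  Increasing : List L → Set
  Increasing []             = Data.Unit.⊤ where import Data.Unit
  Increasing (a ∷ [])       = Data.Unit.⊤ where import Data.Unit
  Increasing (a ∷ b ∷ rest) = (a <L b) × Increasing (b ∷ rest)

  LexLess : List L → List L → Set
  LexLess []       _        = Data.Empty.⊥ where import Data.Empty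
  LexLess (_ ∷ _)  []       = Data.Empty.⊥ where import Data.Empty
  LexLess (a ∷ as) (b ∷ bs) = (a <L b) ⊎ ((a ≡ b) × LexLess as bs)

  IsELLabeling : Set
  IsELLabeling =
    ∀ (x y : E) → Chain x y →
    Σ (Chain x y) λ c →
      Increasing (labels c)
      × (∀ (c' : Chain x y) → Increasing (labels c') → verts c' ≡ verts c)
      × (∀ (c' : Chain x y) → verts c' ≢ verts c → LexLess (labels c) (labels c'))

module Dual {E L : Set} (_⋖_ : E → E → Set)
            (label : ∀ {x y} → x ⋖ y → L)
            (_<L_ : L → L → Set) where

  _⋖*_ : E → E → Set
  y ⋖* x = x ⋖ y

  label* : ∀ {y x} → y ⋖* x → L
  label* e = label e

  _<L*_ : L → L → Set
  a <L* b = b <L a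

  IsDualELLabeling : Set
  IsDualELLabeling = ELTheory.IsELLabeling _⋖*_ label* _<L*_

-- Pointed partitions of [n] (elements encoded as Fin n, so i ↦ i+1).
-- A pointed partition is encoded by the map sending every element to
-- the point of its block; such maps are exactly the idempotent maps
-- f : [n] → [n] (blocks = fibres, points = fixed points).

isIdem : ∀ {n} → Vec (Fin n) n → Bool
isIdem {n} f = and (map (λ i → ⌊ lookup f (lookup f i) ≟ lookup f i ⌋) (allFin n))

PointedPartition : ℕ → Set
PointedPartition n = Σ (Vec (Fin n) n) (λ f → T (isIdem f))

pt : ∀ {n} → PointedPartition n → Fin n → Fin n
pt π i = lookup (proj₁ π) i

IsBlockMin : ∀ {n} → PointedPartition n → Fin n → Fin n → Set
IsBlockMin π p a = (pt π a ≡ p) × (∀ j → pt π j ≡ p → a Data.Fin.≤ j)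

-- underlying map of the partition obtained by merging the blocks with
-- points p and q, the merged block getting point p if u = true
-- (a 1-merge) and point q if u = false (a 0-merge).
mergeMap : ∀ {n} → PointedPartition n → Fin n → Fin n → Bool → Vec (Fin n) n
mergeMap π p q u =
  tabulate λ i →
    if ⌊ pt π i ≟ p ⌋ ∨ ⌊ pt π i ≟ q ⌋
    then (if u then p else q)
    else pt π i

record Cover {n : ℕ} (π π' : PointedPartition n) : Set where
  field
    p q    : Fin n
    p-pt   : pt π p ≡ p
    q-pt   : pt π q ≡ q
    p≢q    : p ≢ q
    a b    : Fin n
    a-min  : IsBlockMin π p a
    b-min  : IsBlockMin π q b
    a<b    : a < b
    u      : Bool
    result : proj₁ π' ≡ mergeMap π p q u

-- The label poset Λ_n^•: elements (a,b)^u with a < b, ordered as the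
-- ordinal sum A_1 ⊕ C_1 ⊕ ⋯ ⊕ A_{n-1} ⊕ C_{n-1}
-- (u = false ↔ superscript 0, u = true ↔ superscript 1).

record Λ (n : ℕ) : Set where
  constructor ⟨_,_⟩^_[_]
  field
    fst snd : Fin n
    sup     : Bool
    fst<snd : fst < snd

data _<Λ_ {n : ℕ} : Λ n → Λ n → Set where
  diff-a : ∀ {a b u h a' b' u' h'} → a < a' →
           (⟨ a , b ⟩^ u [ h ]) <Λ (⟨ a' , b' ⟩^ u' [ h' ])
  -- same a: A_a (antichain, u = 0) below C_a (chain, u = 1)
  A<C    : ∀ {a b h b' h'} →
           (⟨ a , b ⟩^ false [ h ]) <Λ (⟨ a , b' ⟩^ true [ h' ])
  in-C   : ∀ {a b h b' h'} → b < b' →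
           (⟨ a , b ⟩^ true [ h ]) <Λ (⟨ a , b' ⟩^ true [ h' ])

λ• : ∀ {n} {π π' : PointedPartition n} → Cover π π' → Λ n
λ• c = ⟨ Cover.a c , Cover.b c ⟩^ Cover.u c [ Cover.a<b c ]

{-# OPTIONS --safe #-}
-- A pointed partition is its idempotent point map, and y refines x in Π_n^• exactly when
-- x ∘ y = x and y ∘ x = x.  A maximal chain of [x,y] in the dual order splits x into y one
-- block at a time.  The greedy split at x towards y takes the largest minimum m of an x-block
-- that is not yet a y-block with the same point p.  If that block contains a y-block other
-- than those of m and of p, the greedy split detaches the one with the largest minimum b
-- (label (m,b)¹); otherwise the block is exactly these two y-blocks and is halved into them
-- (label (m,β)⁰, with β the minimum of the y-block of p).  Three facts make the greedy chain
-- the unique increasing and the lexicographically first maximal chain of the dual interval: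
-- the greedy label is the largest label of a cover of x above y and is attained only by the
-- greedy cover; greedy labels strictly decrease along the greedy chain; and a non-greedy first
-- cover is never followed by a greedy cover of smaller label.
module Submission where

open import Defs
open import Data.Bool using (true; false; if_then_else_; _∨_; not)
open import Data.Bool.Properties using (T-irrelevant)
open import Data.Empty using (⊥; ⊥-elim)
open import Data.Fin as F using (Fin)
import Data.Fin.Properties as F
open import Data.Fin.Subset as Subset using (Subset; ∣_∣; _⊂_)
open import Data.Fin.Subset.Properties using (p⊂q⇒∣p∣<∣q∣)
open import Data.List using ([]; _∷_)
open import Data.List.Base using (allFin)
open import Data.List.Membership.Propositional.Properties using (∈-allFin)
import Data.List.Relation.Unary.All as All
open import Data.List.Relation.Unary.All.Properties using (all⁺; all⁻)
open import Data.Nat using (ℕ; _≤_)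
import Data.Nat as ℕ
import Data.Nat.Properties as ℕ
open import Data.Nat.Induction using (<-wellFounded)
open import Data.Product using (Σ; _×_; _,_; proj₁; proj₂)
open import Data.Sum using (_⊎_; inj₁; inj₂; [_,_]′)
open import Data.Unit using (tt)
open import Data.Vec using (lookup; tabulate)
open import Data.Vec.Properties using (lookup∘tabulate; []=⇒lookup; lookup⇒[]=)
open import Data.Vec.Relation.Binary.Pointwise.Extensional using (ext; Pointwise-≡⇒≡)
open import Function using (_∘_)
open import Induction.WellFounded using (Acc; acc)
open import Relation.Binary.Definitions using (DecidableEquality)
open import Relation.Binary.PropositionalEquality using (_≡_; _≢_; refl; sym; trans; cong; subst; module ≡-Reasoning)
open import Relation.Nullary using (¬_; yes; no)
open import Relation.Nullary.Decidable using (⌊_⌋; toWitness; fromWitness; _×-dec_; _→-dec_; ¬?)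
open import Relation.Unary using (Decidable)

module GreedyEL {E L : Set} (_⋖_ : E → E → Set)
                (label : ∀ {x y} → x ⋖ y → L)
                (_<L_ : L → L → Set)
                (_⊑_ : E → E → Set) where

  open ELTheory _⋖_ label _<L_

  record Step (x y : E) (size : E → E → ℕ) : Set where
    field
      {target} : E
      edge     : x ⋖ target
      towards  : target ⊑ y
      smaller  : size target y ℕ.< size x y

  record GreedyDescent : Set₁ where
    field
      _≟_     : DecidableEquality E
      ⊑-refl  : ∀ {x} → x ⊑ x
      ⊑-trans : ∀ {x y z} → x ⊑ y → y ⊑ z → x ⊑ z
      ⋖⇒⊑     : ∀ {x y} → x ⋖ y → x ⊑ y
      ⋖-⊑-asym : ∀ {x y} → x ⋖ y → y ⊑ x → ⊥
      size    : E → E → ℕ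
      step    : ∀ {x y} → x ⊑ y → x ≢ y → Step x y size
      step-least : ∀ {x y z} (r : x ⊑ y) (x≢y : x ≢ y) (e : x ⋖ z) → z ⊑ y →
        let s = step r x≢y in
        label (Step.edge s) <L label e ⊎ (z ≡ Step.target s × label e ≡ label (Step.edge s))
      step-increasing : ∀ {x y} (r : x ⊑ y) (x≢y : x ≢ y) →
        let s = step r x≢y in
        ∀ (r′ : Step.target s ⊑ y) (t≢y : Step.target s ≢ y) →
        label (Step.edge s) <L label (Step.edge (step r′ t≢y))
      -- a first edge that is not greedy cannot start an increasing chain towards y
      step-no-detour : ∀ {x y z} (r : x ⊑ y) (x≢y : x ≢ y) (e : x ⋖ z) → z ⊑ y →
        label (Step.edge (step r x≢y)) <L label e →
        ¬ (z ≡ y ⊎ Σ (z ⊑ y) λ r′ → Σ (z ≢ y) λ z≢y → label e <L label (Step.edge (step r′ z≢y)))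

  module _ (G : GreedyDescent) where
    open GreedyDescent G

    chain⇒⊑ : ∀ {x y} → Chain x y → x ⊑ y
    chain⇒⊑ []      = ⊑-refl
    chain⇒⊑ (e ∷ c) = ⊑-trans (⋖⇒⊑ e) (chain⇒⊑ c)

    nonempty-chain⇒≢ : ∀ {x y z} → x ⋖ z → Chain z y → x ≢ y
    nonempty-chain⇒≢ e c refl = ⋖-⊑-asym e (chain⇒⊑ c)

    greedyChain : ∀ {x y} → x ⊑ y → Acc ℕ._<_ (size x y) → Chain x y
    greedyChain {x} {y} r (acc rs) with x ≟ y
    ... | yes refl = []
    ... | no x≢y   = Step.edge s ∷ greedyChain (Step.towards s) (rs (Step.smaller s))
      where s = step r x≢y

    increasing-starts-greedily : ∀ {x y z} (r : x ⊑ y) (x≢y : x ≢ y) (e : x ⋖ z) (c : Chain z y) →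
      Increasing (labels (e ∷ c)) →
      z ≡ Step.target (step r x≢y) × label e ≡ label (Step.edge (step r x≢y))
    increasing-starts-greedily {x} r x≢y e c inc with step-least r x≢y e (chain⇒⊑ c)
    ... | inj₂ greedy = greedy
    ... | inj₁ lt     = ⊥-elim (step-no-detour r x≢y e (chain⇒⊑ c) lt (continuation c inc))
      where
      continuation : ∀ {z y} {e : x ⋖ z} (c : Chain z y) → Increasing (labels (e ∷ c)) →
        z ≡ y ⊎ Σ (z ⊑ y) λ r′ → Σ (z ≢ y) λ z≢y → label e <L label (Step.edge (step r′ z≢y))
      continuation []                    _          = inj₁ refl
      continuation {e = e} (e′ ∷ c′) (lt′ , inc′) =
        inj₂ (r′ , z≢y , subst (label e <L_) (proj₂ (increasing-starts-greedily r′ z≢y e′ c′ inc′)) lt′)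
        where
        r′  = chain⇒⊑ (e′ ∷ c′)
        z≢y = nonempty-chain⇒≢ e′ c′

    greedyChain-increasing-after : ∀ {x y} (l : L) →
      (∀ (r′ : x ⊑ y) (x≢y : x ≢ y) → l <L label (Step.edge (step r′ x≢y))) →
      (r : x ⊑ y) (a : Acc ℕ._<_ (size x y)) → Increasing (l ∷ labels (greedyChain r a))
    greedyChain-increasing-after {x} {y} l below r (acc rs) with x ≟ y
    ... | yes refl = tt
    ... | no x≢y   =
      below r x≢y ,
      greedyChain-increasing-after (label (Step.edge s)) (step-increasing r x≢y)
                                   (Step.towards s) (rs (Step.smaller s))
      where s = step r x≢y

    greedyChain-increasing : ∀ {x y} (r : x ⊑ y) (a : Acc ℕ._<_ (size x y)) →
      Increasing (labels (greedyChain r a))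
    greedyChain-increasing {x} {y} r (acc rs) with x ≟ y
    ... | yes refl = tt
    ... | no x≢y   =
      greedyChain-increasing-after (label (Step.edge s)) (step-increasing r x≢y)
                                   (Step.towards s) (rs (Step.smaller s))
      where s = step r x≢y

    increasing⇒greedyChain : ∀ {x y} (c : Chain x y) → Increasing (labels c) →
      (r : x ⊑ y) (a : Acc ℕ._<_ (size x y)) → verts c ≡ verts (greedyChain r a)
    increasing⇒greedyChain {x} {y} c inc r (acc rs) with x ≟ y | c
    ... | yes refl | []     = refl
    ... | yes refl | e ∷ c′ = ⊥-elim (nonempty-chain⇒≢ e c′ refl)
    ... | no x≢y   | []     = ⊥-elim (x≢y refl)
    ... | no x≢y   | e ∷ c′ with increasing-starts-greedily r x≢y e c′ inc
    ...   | refl , _ = cong (x ∷_) (increasing⇒greedyChain c′ (tail inc) _ (rs (Step.smaller (step r x≢y))))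
      where
      tail : ∀ {l ls} → Increasing (l ∷ ls) → Increasing ls
      tail {ls = []}    _       = tt
      tail {ls = _ ∷ _} (_ , i) = i

    greedyChain-lexLeast : ∀ {x y} (c : Chain x y) (r : x ⊑ y) (a : Acc ℕ._<_ (size x y)) →
      verts c ≢ verts (greedyChain r a) → LexLess (labels (greedyChain r a)) (labels c)
    greedyChain-lexLeast {x} {y} c r (acc rs) c≢g with x ≟ y | c
    ... | yes refl | []     = ⊥-elim (c≢g refl)
    ... | yes refl | e ∷ c′ = ⊥-elim (nonempty-chain⇒≢ e c′ refl)
    ... | no x≢y   | []     = ⊥-elim (x≢y refl)
    ... | no x≢y   | e ∷ c′ with step-least r x≢y e (chain⇒⊑ c′)
    ...   | inj₁ lt          = inj₁ lt
    ...   | inj₂ (refl , eq) =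
      inj₂ (sym eq , greedyChain-lexLeast c′ _ (rs (Step.smaller (step r x≢y))) (c≢g ∘ cong (x ∷_)))

    isELLabeling : IsELLabeling
    isELLabeling x y c =
      greedyChain r a , greedyChain-increasing r a ,
      (λ c′ inc → increasing⇒greedyChain c′ inc r a) , (λ c′ → greedyChain-lexLeast c′ r a)
      where
      r = chain⇒⊑ c
      a = <-wellFounded (size x y)

Greatest Least : ∀ {m} → (Fin m → Set) → Set
Greatest P = Σ _ λ i → P i × (∀ j → P j → j F.≤ i)
Least    P = Σ _ λ i → P i × (∀ j → P j → i F.≤ j)

greatest? : ∀ {m} {P : Fin m → Set} → Decidable P → (∀ i → ¬ P i) ⊎ Greatest P
greatest? {ℕ.zero}  P? = inj₁ λ ()
greatest? {ℕ.suc m} {P} P? with greatest? (P? ∘ F.suc)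
... | inj₂ (i , pi , max) = inj₂ (F.suc i , pi , λ { F.zero _ → ℕ.z≤n ; (F.suc j) pj → ℕ.s≤s (max j pj) })
... | inj₁ none with P? F.zero
...   | yes p0 = inj₂ (F.zero , p0 , λ { F.zero _ → ℕ.z≤n ; (F.suc j) pj → ⊥-elim (none j pj) })
...   | no ¬p0 = inj₁ λ { F.zero → ¬p0 ; (F.suc j) → none j }

least : ∀ {m} {P : Fin m → Set} → Decidable P → ∀ k → P k → Least P
least {ℕ.suc m} {P} P? k pk with P? F.zero
... | yes p0 = F.zero , p0 , λ _ _ → ℕ.z≤n
least {ℕ.suc m} {P} P? F.zero    pk | no ¬p0 = ⊥-elim (¬p0 pk)
least {ℕ.suc m} {P} P? (F.suc k) pk | no ¬p0 with least (P? ∘ F.suc) k pk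
... | i , pi , min = F.suc i , pi , λ { F.zero p → ⊥-elim (¬p0 p) ; (F.suc j) pj → ℕ.s≤s (min j pj) }

module _ {n : ℕ} where

  private
    PP = PointedPartition n

  pt-idem : (π : PP) → ∀ i → pt π (pt π i) ≡ pt π i
  pt-idem (f , t) i = toWitness (All.lookup (all⁺ _ (allFin n) t) (∈-allFin i))

  fromIdempotent : (f : Fin n → Fin n) → (∀ i → f (f i) ≡ f i) → PP
  fromIdempotent f idem =
    v , all⁻ (λ i → ⌊ lookup v (lookup v i) F.≟ lookup v i ⌋) {xs = allFin n}
             (All.tabulate λ {i} _ → fromWitness (idem′ i))
    where
    v = tabulate f
    idem′ : ∀ i → lookup v (lookup v i) ≡ lookup v i
    idem′ i rewrite lookup∘tabulate f i | lookup∘tabulate f (f i) = idem i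

  pt-fromIdempotent : ∀ f idem i → pt (fromIdempotent f idem) i ≡ f i
  pt-fromIdempotent f _ = lookup∘tabulate f

  pt-ext : (π σ : PP) → (∀ i → pt π i ≡ pt σ i) → π ≡ σ
  pt-ext (v , t) (w , s) h with Pointwise-≡⇒≡ {xs = v} {w} (ext h)
  ... | refl = cong (v ,_) (T-irrelevant t s)

  _≟PP_ : DecidableEquality PP
  π ≟PP σ with F.all? (λ i → pt π i F.≟ pt σ i)
  ... | yes same = yes (pt-ext π σ same)
  ... | no  diff = no λ { refl → diff λ _ → refl }

  record _≼_ (y x : PP) : Set where
    field
      same-block : ∀ i → pt x (pt y i) ≡ pt x i
      keeps-point : ∀ i → pt y (pt x i) ≡ pt x i
  open _≼_

  ≼-refl : ∀ {x} → x ≼ x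
  ≼-refl {x} = record { same-block = pt-idem x ; keeps-point = pt-idem x }

  ≼-trans : ∀ {z y x} → z ≼ y → y ≼ x → z ≼ x
  ≼-trans {z} {y} {x} z≼y y≼x = record
    { same-block  = λ i → begin
        pt x (pt z i)          ≡⟨ same-block y≼x (pt z i) ⟨
        pt x (pt y (pt z i))   ≡⟨ cong (pt x) (same-block z≼y i) ⟩
        pt x (pt y i)          ≡⟨ same-block y≼x i ⟩
        pt x i                 ∎
    ; keeps-point = λ i → begin
        pt z (pt x i)          ≡⟨ cong (pt z) (keeps-point y≼x i) ⟨
        pt z (pt y (pt x i))   ≡⟨ keeps-point z≼y (pt x i) ⟩
        pt y (pt x i)          ≡⟨ keeps-point y≼x i ⟩
        pt x i                 ∎
    }
    where open ≡-Reasoning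

  merge-result : ∀ (z x : PP) p q u → let s = if u then p else q in
    (∀ i → pt z i ≡ p → pt x i ≡ s) →
    (∀ i → pt z i ≡ q → pt x i ≡ s) →
    (∀ i → pt z i ≢ p → pt z i ≢ q → pt x i ≡ pt z i) →
    proj₁ x ≡ mergeMap z p q u
  merge-result z x p q u from-p from-q elsewhere =
    Pointwise-≡⇒≡ (ext λ i → trans (pt-x i) (sym (lookup∘tabulate _ i)))
    where
    pt-x : ∀ i → pt x i ≡ (if ⌊ pt z i F.≟ p ⌋ ∨ ⌊ pt z i F.≟ q ⌋ then (if u then p else q) else pt z i)
    pt-x i with pt z i F.≟ p | pt z i F.≟ q
    ... | yes zp | _      = from-p i zp
    ... | no zp  | yes zq = from-q i zq
    ... | no zp  | no zq  = elsewhere i zp zq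

  module CoverAnatomy {z x : PP} (e : Cover z x) where
    open Cover e

    merged : Fin n
    merged = if u then p else q

    merged-pt : pt z merged ≡ merged
    merged-pt with u
    ... | true  = p-pt
    ... | false = q-pt

    pt-merge : ∀ i → pt x i ≡ (if ⌊ pt z i F.≟ p ⌋ ∨ ⌊ pt z i F.≟ q ⌋ then merged else pt z i)
    pt-merge i = trans (cong (λ v → lookup v i) result) (lookup∘tabulate _ i)

    data Fate (i : Fin n) : Set where
      in-p      : pt z i ≡ p → pt x i ≡ merged → Fate i
      in-q      : pt z i ≢ p → pt z i ≡ q → pt x i ≡ merged → Fate i
      elsewhere : pt z i ≢ p → pt z i ≢ q → pt x i ≡ pt z i → Fate i

    fate : ∀ i → Fate i
    fate i with pt z i F.≟ p | pt z i F.≟ q | pt-merge i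
    ... | yes zp | _      | eq = in-p zp eq
    ... | no zp  | yes zq | eq = in-q zp zq eq
    ... | no zp  | no zq  | eq = elsewhere zp zq eq

    from-p : ∀ {i} → pt z i ≡ p → pt x i ≡ merged
    from-p {i} zp with fate i
    ... | in-p _ eq          = eq
    ... | in-q ¬zp _ _       = ⊥-elim (¬zp zp)
    ... | elsewhere ¬zp _ _  = ⊥-elim (¬zp zp)

    from-q : ∀ {i} → pt z i ≡ q → pt x i ≡ merged
    from-q {i} zq with fate i
    ... | in-p _ eq          = eq
    ... | in-q _ _ eq        = eq
    ... | elsewhere _ ¬zq _  = ⊥-elim (¬zq zq)

    to-merged : ∀ i → pt x i ≡ merged → pt z i ≡ p ⊎ pt z i ≡ q
    to-merged i xm with fate i
    ... | in-p zp _             = inj₁ zp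
    ... | in-q _ zq _           = inj₂ zq
    ... | elsewhere ¬zp ¬zq eq  = ⊥-elim (merged≢ (trans (sym eq) xm))
      where
      merged≢ : pt z i ≢ merged
      merged≢ with u
      ... | true  = ¬zp
      ... | false = ¬zq

    not-merged : ∀ i → pt x i ≢ merged → pt x i ≡ pt z i
    not-merged i ¬xm with fate i
    ... | in-p _ eq         = ⊥-elim (¬xm eq)
    ... | in-q _ _ eq       = ⊥-elim (¬xm eq)
    ... | elsewhere _ _ eq  = eq

    pt-cong : ∀ {j k} → pt z j ≡ pt z k → pt x j ≡ pt x k
    pt-cong {j} {k} eq = trans (pt-merge j) (trans (cong merge eq) (sym (pt-merge k)))
      where merge = λ c → if ⌊ c F.≟ p ⌋ ∨ ⌊ c F.≟ q ⌋ then merged else c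

  cover⇒≼ : ∀ {z x} → Cover z x → z ≼ x
  cover⇒≼ {z} {x} e = record { same-block = λ i → pt-cong (pt-idem z i) ; keeps-point = keeps }
    where
    open CoverAnatomy e
    keeps : ∀ i → pt z (pt x i) ≡ pt x i
    keeps i with fate i
    ... | in-p _ eq        rewrite eq = merged-pt
    ... | in-q _ _ eq      rewrite eq = merged-pt
    ... | elsewhere _ _ eq rewrite eq = pt-idem z i

  cover-≽-absurd : ∀ {z x} → Cover z x → x ≼ z → ⊥
  cover-≽-absurd {z} {x} e x≼z = p≢q (begin
    p              ≡⟨ p-pt ⟨
    pt z p         ≡⟨ same-block x≼z p ⟨
    pt z (pt x p)  ≡⟨ cong (pt z) (trans (from-p p-pt) (sym (from-q q-pt))) ⟩
    pt z (pt x q)  ≡⟨ same-block x≼z q ⟩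
    pt z q         ≡⟨ q-pt ⟩
    q              ∎)
    where
    open Cover e
    open CoverAnatomy e
    open ≡-Reasoning

  BlockMin : (Fin n → Fin n) → Fin n → Set
  BlockMin f i = ∀ j → f j ≡ f i → i F.≤ j

  blockMin? : ∀ f → Decidable (BlockMin f)
  blockMin? f i = F.all? λ j → (f j F.≟ f i) →-dec (i F.≤? j)

  blockMinOf : ∀ (f : Fin n → Fin n) j → Σ (Fin n) λ c → f c ≡ f j × BlockMin f c
  blockMinOf f j with least (λ k → f k F.≟ f j) j refl
  ... | c , fc , min = c , fc , λ k eq → min k (trans eq fc)

  module Greedy (x y : PP) where
    X Y : Fin n → Fin n
    X = pt x
    Y = pt y

    Unfinished : Fin n → Set
    Unfinished i = BlockMin X i × Σ (Fin n) λ j → X j ≡ X i × Y j ≢ X j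

    Detachable : Fin n → Fin n → Set
    Detachable m j = BlockMin Y j × X j ≡ X m × Y j ≢ Y m × Y j ≢ X m

    unfinished? : Decidable Unfinished
    unfinished? i = blockMin? X i ×-dec F.any? λ j → (X j F.≟ X i) ×-dec ¬? (Y j F.≟ X j)

    detachable? : ∀ m → Decidable (Detachable m)
    detachable? m j =
      blockMin? Y j ×-dec ((X j F.≟ X m) ×-dec (¬? (Y j F.≟ Y m) ×-dec ¬? (Y j F.≟ X m)))

    data SplitKind (m : Fin n) : Set where
      detach : Greatest (Detachable m) → SplitKind m
      halve  : (∀ j → ¬ Detachable m j) → (β : Fin n) → Y β ≡ X m → BlockMin Y β → SplitKind m

    record SplitSite : Set where
      constructor site
      field
        m          : Fin n
        unfinished : Unfinished m
        greatest   : ∀ i → Unfinished i → i F.≤ m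
        kind       : SplitKind m

    splitSite : y ≼ x → Σ (Fin n) (λ j → Y j ≢ X j) → SplitSite
    splitSite r (j , Yj≢Xj) with greatest? unfinished? | blockMinOf X j
    ... | inj₁ none | c , Xc≡Xj , c-min = ⊥-elim (none c (c-min , j , sym Xc≡Xj , Yj≢Xj))
    ... | inj₂ (m , m-unfinished , m-greatest) | _ = site m m-unfinished m-greatest kind
      where
      kind : SplitKind m
      kind with greatest? (detachable? m)
      ... | inj₂ b = detach b
      ... | inj₁ none with blockMinOf Y (X m)
      ...   | β , Yβ , β-min = halve none β (trans Yβ (keeps-point r m)) β-min

    module Splitting (r : y ≼ x) where
      XX : ∀ i → X (X i) ≡ X i
      XX = pt-idem x
      YY : ∀ i → Y (Y i) ≡ Y i
      YY = pt-idem y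
      XY : ∀ i → X (Y i) ≡ X i
      XY = same-block r
      YX : ∀ i → Y (X i) ≡ X i
      YX = keeps-point r

      Y⇒X : ∀ {i j} → Y i ≡ Y j → X i ≡ X j
      Y⇒X {i} {j} eq = trans (sym (XY i)) (trans (cong X eq) (XY j))

      record Split : Set where
        field
          z        : PP
          cover    : Cover z x
          refines  : y ≼ z
          progress : Σ (Fin n) λ i → X i ≢ Y i × pt z i ≡ Y i

      module Detach (m : Fin n) (m-min : BlockMin X m) (b : Fin n) (b-det : Detachable m b) where
        p q : Fin n
        p = X m
        q = Y b

        b-min : BlockMin Y b
        b-min = proj₁ b-det
        Xb≡p : X b ≡ p
        Xb≡p = proj₁ (proj₂ b-det)
        q≢Ym : q ≢ Y m
        q≢Ym = proj₁ (proj₂ (proj₂ b-det))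
        q≢p : q ≢ p
        q≢p = proj₂ (proj₂ (proj₂ b-det))
        Yq≡q : Y q ≡ q
        Yq≡q = YY b

        q-not-x-point : ∀ i → X i ≢ q
        q-not-x-point i eq = q≢p (begin
          q          ≡⟨ eq ⟨
          X i        ≡⟨ XX i ⟨
          X (X i)    ≡⟨ cong X eq ⟩
          X q        ≡⟨ XY b ⟩
          X b        ≡⟨ Xb≡p ⟩
          p          ∎)
          where open ≡-Reasoning

        zf : Fin n → Fin n
        zf i with Y i F.≟ q
        ... | yes _ = q
        ... | no _  = X i

        zf-in : ∀ i → Y i ≡ q → zf i ≡ q
        zf-in i eq with Y i F.≟ q
        ... | yes _ = refl
        ... | no ne = ⊥-elim (ne eq)

        zf-out : ∀ i → Y i ≢ q → zf i ≡ X i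
        zf-out i ne with Y i F.≟ q
        ... | yes eq = ⊥-elim (ne eq)
        ... | no _   = refl

        zf-idem : ∀ i → zf (zf i) ≡ zf i
        zf-idem i with Y i F.≟ q
        ... | yes _ = zf-in q Yq≡q
        ... | no _  = trans (zf-out (X i) (λ eq → q-not-x-point i (trans (sym (YX i)) eq))) (XX i)

        z : PP
        z = fromIdempotent zf zf-idem

        Z : Fin n → Fin n
        Z = pt z

        Z-in : ∀ i → Y i ≡ q → Z i ≡ q
        Z-in i eq = trans (pt-fromIdempotent zf zf-idem i) (zf-in i eq)

        Z-out : ∀ i → Y i ≢ q → Z i ≡ X i
        Z-out i ne = trans (pt-fromIdempotent zf zf-idem i) (zf-out i ne)

        Z-cases : ∀ i → (Y i ≡ q × Z i ≡ q) ⊎ (Y i ≢ q × Z i ≡ X i)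
        Z-cases i with Y i F.≟ q
        ... | yes eq = inj₁ (eq , Z-in i eq)
        ... | no ne  = inj₂ (ne , Z-out i ne)

        Zp≡p : Z p ≡ p
        Zp≡p = trans (Z-out p (λ eq → q≢p (trans (sym eq) (YX m)))) (XX m)

        m-blockMin : IsBlockMin z p m
        m-blockMin = Z-out m (q≢Ym ∘ sym) , least-m
          where
          least-m : ∀ j → Z j ≡ p → m F.≤ j
          least-m j eq with Z-cases j
          ... | inj₁ (_ , Zj≡q)  = ⊥-elim (q≢p (trans (sym Zj≡q) eq))
          ... | inj₂ (_ , Zj≡Xj) = m-min j (trans (sym Zj≡Xj) eq)

        b-blockMin : IsBlockMin z q b
        b-blockMin = Z-in b refl , least-b
          where
          least-b : ∀ j → Z j ≡ q → b F.≤ j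
          least-b j eq with Z-cases j
          ... | inj₁ (Yj≡q , _)  = b-min j Yj≡q
          ... | inj₂ (_ , Zj≡Xj) = ⊥-elim (q-not-x-point j (trans (sym Zj≡Xj) eq))

        cover : Cover z x
        cover = record
          { p = p ; q = q
          ; p-pt = Zp≡p
          ; q-pt = Z-in q Yq≡q
          ; p≢q = q≢p ∘ sym
          ; a = m ; b = b ; a-min = m-blockMin ; b-min = b-blockMin
          ; a<b = F.≤∧≢⇒< (m-min b Xb≡p) (λ eq → q≢Ym (cong Y (sym eq)))
          ; u = true
          ; result = merge-result z x p q true from-p from-q elsewhere }
          where
          from-p : ∀ i → Z i ≡ p → X i ≡ p
          from-p i eq with Z-cases i
          ... | inj₁ (_ , Zi≡q)  = ⊥-elim (q≢p (trans (sym Zi≡q) eq))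
          ... | inj₂ (_ , Zi≡Xi) = trans (sym Zi≡Xi) eq
          from-q : ∀ i → Z i ≡ q → X i ≡ p
          from-q i eq with Z-cases i
          ... | inj₁ (Yi≡q , _)  = trans (Y⇒X Yi≡q) Xb≡p
          ... | inj₂ (_ , Zi≡Xi) = ⊥-elim (q-not-x-point i (trans (sym Zi≡Xi) eq))
          elsewhere : ∀ i → Z i ≢ p → Z i ≢ q → X i ≡ Z i
          elsewhere i _ Zi≢q with Z-cases i
          ... | inj₁ (_ , Zi≡q)  = ⊥-elim (Zi≢q Zi≡q)
          ... | inj₂ (_ , Zi≡Xi) = sym Zi≡Xi

        refines : y ≼ z
        refines = record { same-block = same ; keeps-point = keeps }
          where
          same : ∀ i → Z (Y i) ≡ Z i
          same i with Z-cases i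
          ... | inj₁ (Yi≡q , Zi≡q) = trans (Z-in (Y i) (trans (YY i) Yi≡q)) (sym Zi≡q)
          ... | inj₂ (Yi≢q , Zi≡Xi) =
            trans (Z-out (Y i) (λ eq → Yi≢q (trans (sym (YY i)) eq))) (trans (XY i) (sym Zi≡Xi))
          keeps : ∀ i → Y (Z i) ≡ Z i
          keeps i with Z-cases i
          ... | inj₁ (_ , Zi≡q)  rewrite Zi≡q = Yq≡q
          ... | inj₂ (_ , Zi≡Xi) rewrite Zi≡Xi = YX i

        unsplit-misses-q : ∀ {j m′} → Z j ≡ Z m′ → Y j ≢ Z j → Y m′ ≢ q
        unsplit-misses-q {j} {m′} Zj≡Zm′ Yj≢Zj Ym′≡q with Y j F.≟ q
        ... | yes Yj≡q = Yj≢Zj (trans Yj≡q (sym (Z-in j Yj≡q)))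
        ... | no Yj≢q  = q-not-x-point j (trans (sym (Z-out j Yj≢q)) (trans Zj≡Zm′ (Z-in m′ Ym′≡q)))

        split : Split
        split = record
          { z = z ; cover = cover ; refines = refines
          ; progress = b , (λ eq → q≢p (trans (sym eq) Xb≡p)) , Z-in b refl }

      module Halve (m : Fin n) (m-min : BlockMin X m) (m-unfinished : Σ (Fin n) λ j → X j ≡ X m × Y j ≢ X j)
                   (none : ∀ j → ¬ Detachable m j) (β : Fin n) (Yβ≡p : Y β ≡ X m) (β-min : BlockMin Y β) where
        p p′ : Fin n
        p  = X m
        p′ = Y m

        two-blocks : ∀ j → X j ≡ p → Y j ≡ p′ ⊎ Y j ≡ p
        two-blocks j Xj≡p with blockMinOf Y j
        ... | c , Yc≡Yj , c-min with Y c F.≟ p′ | Y c F.≟ p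
        ...   | yes eq | _      = inj₁ (trans (sym Yc≡Yj) eq)
        ...   | no _   | yes eq = inj₂ (trans (sym Yc≡Yj) eq)
        ...   | no ne  | no ne′ = ⊥-elim (none c (c-min , trans (Y⇒X Yc≡Yj) Xj≡p , ne , ne′))

        p′≢p : p′ ≢ p
        p′≢p = refute m-unfinished
          where
          refute : Σ (Fin n) (λ j → X j ≡ p × Y j ≢ X j) → p′ ≢ p
          refute (j , Xj≡p , Yj≢Xj) eq with two-blocks j Xj≡p
          ... | inj₁ Yj≡p′ = Yj≢Xj (trans Yj≡p′ (trans eq (sym Xj≡p)))
          ... | inj₂ Yj≡p  = Yj≢Xj (trans Yj≡p (sym Xj≡p))

        p′-not-x-point : ∀ i → X i ≢ p′
        p′-not-x-point i eq = p′≢p (begin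
          p′         ≡⟨ eq ⟨
          X i        ≡⟨ XX i ⟨
          X (X i)    ≡⟨ cong X eq ⟩
          X p′       ≡⟨ XY m ⟩
          p          ∎)
          where open ≡-Reasoning

        Xβ≡p : X β ≡ p
        Xβ≡p = trans (sym (XY β)) (trans (cong X Yβ≡p) (XX m))

        zf : Fin n → Fin n
        zf i with X i F.≟ p
        ... | yes _ = Y i
        ... | no _  = X i

        zf-in : ∀ i → X i ≡ p → zf i ≡ Y i
        zf-in i eq with X i F.≟ p
        ... | yes _ = refl
        ... | no ne = ⊥-elim (ne eq)

        zf-out : ∀ i → X i ≢ p → zf i ≡ X i
        zf-out i ne with X i F.≟ p
        ... | yes eq = ⊥-elim (ne eq)
        ... | no _   = refl

        zf-idem : ∀ i → zf (zf i) ≡ zf i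
        zf-idem i with X i F.≟ p
        ... | yes eq = trans (zf-in (Y i) (trans (XY i) eq)) (YY i)
        ... | no ne  = trans (zf-out (X i) (λ eq → ne (trans (sym (XX i)) eq))) (XX i)

        z : PP
        z = fromIdempotent zf zf-idem

        Z : Fin n → Fin n
        Z = pt z

        Z-in : ∀ i → X i ≡ p → Z i ≡ Y i
        Z-in i eq = trans (pt-fromIdempotent zf zf-idem i) (zf-in i eq)

        Z-out : ∀ i → X i ≢ p → Z i ≡ X i
        Z-out i ne = trans (pt-fromIdempotent zf zf-idem i) (zf-out i ne)

        Z-cases : ∀ i → (X i ≡ p × Z i ≡ Y i) ⊎ (X i ≢ p × Z i ≡ X i)
        Z-cases i with X i F.≟ p
        ... | yes eq = inj₁ (eq , Z-in i eq)
        ... | no ne  = inj₂ (ne , Z-out i ne)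

        m-blockMin : IsBlockMin z p′ m
        m-blockMin = Z-in m refl , least-m
          where
          least-m : ∀ j → Z j ≡ p′ → m F.≤ j
          least-m j eq with Z-cases j
          ... | inj₁ (Xj≡p , _)  = m-min j Xj≡p
          ... | inj₂ (_ , Zj≡Xj) = ⊥-elim (p′-not-x-point j (trans (sym Zj≡Xj) eq))

        β-blockMin : IsBlockMin z p β
        β-blockMin = trans (Z-in β Xβ≡p) Yβ≡p , least-β
          where
          least-β : ∀ j → Z j ≡ p → β F.≤ j
          least-β j eq with Z-cases j
          ... | inj₁ (_ , Zj≡Yj)  = β-min j (trans (sym Zj≡Yj) (trans eq (sym Yβ≡p)))
          ... | inj₂ (Xj≢p , Zj≡Xj) = ⊥-elim (Xj≢p (trans (sym Zj≡Xj) eq))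

        cover : Cover z x
        cover = record
          { p = p′ ; q = p
          ; p-pt = trans (Z-in p′ (XY m)) (YY m)
          ; q-pt = trans (Z-in p (XX m)) (YX m)
          ; p≢q = p′≢p
          ; a = m ; b = β ; a-min = m-blockMin ; b-min = β-blockMin
          ; a<b = F.≤∧≢⇒< (m-min β Xβ≡p) (λ eq → p′≢p (trans (cong Y eq) Yβ≡p))
          ; u = false
          ; result = merge-result z x p′ p false from-p′ from-p elsewhere }
          where
          from-p′ : ∀ i → Z i ≡ p′ → X i ≡ p
          from-p′ i eq with Z-cases i
          ... | inj₁ (Xi≡p , _)  = Xi≡p
          ... | inj₂ (_ , Zi≡Xi) = ⊥-elim (p′-not-x-point i (trans (sym Zi≡Xi) eq))
          from-p : ∀ i → Z i ≡ p → X i ≡ p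
          from-p i eq with Z-cases i
          ... | inj₁ (Xi≡p , _)  = Xi≡p
          ... | inj₂ (_ , Zi≡Xi) = trans (sym Zi≡Xi) eq
          elsewhere : ∀ i → Z i ≢ p′ → Z i ≢ p → X i ≡ Z i
          elsewhere i Zi≢p′ Zi≢p with Z-cases i
          ... | inj₂ (_ , Zi≡Xi) = sym Zi≡Xi
          ... | inj₁ (Xi≡p , Zi≡Yi) with two-blocks i Xi≡p
          ...   | inj₁ Yi≡p′ = ⊥-elim (Zi≢p′ (trans Zi≡Yi Yi≡p′))
          ...   | inj₂ Yi≡p  = ⊥-elim (Zi≢p (trans Zi≡Yi Yi≡p))

        refines : y ≼ z
        refines = record { same-block = same ; keeps-point = keeps }
          where
          same : ∀ i → Z (Y i) ≡ Z i
          same i with Z-cases i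
          ... | inj₁ (Xi≡p , Zi≡Yi) = trans (Z-in (Y i) (trans (XY i) Xi≡p)) (trans (YY i) (sym Zi≡Yi))
          ... | inj₂ (Xi≢p , Zi≡Xi) =
            trans (Z-out (Y i) (λ eq → Xi≢p (trans (sym (XY i)) eq))) (trans (XY i) (sym Zi≡Xi))
          keeps : ∀ i → Y (Z i) ≡ Z i
          keeps i with Z-cases i
          ... | inj₁ (_ , Zi≡Yi) rewrite Zi≡Yi = YY i
          ... | inj₂ (_ , Zi≡Xi) rewrite Zi≡Xi = YX i

        unsplit-outside : ∀ {j m′} → Z j ≡ Z m′ → Y j ≢ Z j → X m′ ≢ p
        unsplit-outside {j} {m′} Zj≡Zm′ Yj≢Zj Xm′≡p with X j F.≟ p
        ... | yes Xj≡p = Yj≢Zj (sym (Z-in j Xj≡p))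
        ... | no Xj≢p  = Xj≢p (begin
          X j          ≡⟨ XX j ⟨
          X (X j)      ≡⟨ cong X (trans (sym (Z-out j Xj≢p)) (trans Zj≡Zm′ (Z-in m′ Xm′≡p))) ⟩
          X (Y m′)     ≡⟨ XY m′ ⟩
          X m′         ≡⟨ Xm′≡p ⟩
          p            ∎)
          where open ≡-Reasoning

        split : Split
        split = record
          { z = z ; cover = cover ; refines = refines
          ; progress = m , (λ eq → p′≢p (sym eq)) , Z-in m refl }

      split : SplitSite → Split
      split (site m (m-min , _) _ (detach (b , b-det , _))) =
        Detach.split m m-min b b-det
      split (site m (m-min , m-witness) _ (halve none β Yβ≡p β-min)) =
        Halve.split m m-min m-witness none β Yβ≡p β-min

      splitLabel : SplitSite → Λ n
      splitLabel s = λ• (Split.cover (split s))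

  <Λ-view : ∀ {a b : Fin n} {u h} {a′ b′ : Fin n} {u′ h′} →
    (⟨ a , b ⟩^ u [ h ]) <Λ (⟨ a′ , b′ ⟩^ u′ [ h′ ]) →
    a F.< a′ ⊎ (a ≡ a′ × u ≡ false × u′ ≡ true) ⊎ (a ≡ a′ × u ≡ true × u′ ≡ true × b F.< b′)
  <Λ-view (diff-a lt) = inj₁ lt
  <Λ-view A<C         = inj₂ (inj₁ (refl , refl , refl))
  <Λ-view (in-C lt)   = inj₂ (inj₂ (refl , refl , refl , lt))

  <Λ-fst : ∀ {l l′ : Λ n} → l <Λ l′ → Λ.fst l F.≤ Λ.fst l′
  <Λ-fst (diff-a lt) = ℕ.<⇒≤ lt
  <Λ-fst A<C         = F.≤-refl
  <Λ-fst (in-C _)    = F.≤-refl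

  <Λ-A<C : ∀ {a b : Fin n} {u h} {a′ b′ : Fin n} {u′ h′} → u ≡ false → u′ ≡ true → a ≡ a′ →
    (⟨ a , b ⟩^ u [ h ]) <Λ (⟨ a′ , b′ ⟩^ u′ [ h′ ])
  <Λ-A<C refl refl refl = A<C

  <Λ-in-C : ∀ {a b : Fin n} {u h} {a′ b′ : Fin n} {u′ h′} → u ≡ true → u′ ≡ true → a ≡ a′ → b F.< b′ →
    (⟨ a , b ⟩^ u [ h ]) <Λ (⟨ a′ , b′ ⟩^ u′ [ h′ ])
  <Λ-in-C refl refl refl = in-C

  Λ-≡ : ∀ {a b : Fin n} {u h} {a′ b′ : Fin n} {u′ h′} → a ≡ a′ → b ≡ b′ → u ≡ u′ →
    (⟨ a , b ⟩^ u [ h ]) ≡ (⟨ a′ , b′ ⟩^ u′ [ h′ ])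
  Λ-≡ {h = h} {h′ = h′} refl refl refl = cong (⟨ _ , _ ⟩^ _ [_]) (F.<-irrelevant h h′)

  <Λ-same-fst : ∀ {l : Λ n} {a b u h} → l <Λ (⟨ a , b ⟩^ u [ h ]) → Λ.fst l ≡ a →
    u ≡ true × (Λ.sup l ≡ false ⊎ (Λ.sup l ≡ true × Λ.snd l F.< b))
  <Λ-same-fst (diff-a lt) refl = ⊥-elim (F.<-irrefl refl lt)
  <Λ-same-fst A<C         _    = refl , inj₁ refl
  <Λ-same-fst (in-C lt)   _    = refl , inj₂ (refl , lt)

  module CoverAbove {z x : PP} (e : Cover z x) (y : PP) (y≼z : y ≼ z) where
    open Cover e public renaming (p to p′; q to q′; p-pt to p′-pt; q-pt to q′-pt; p≢q to p′≢q′;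
      a to a′; b to b′; a-min to a′-min; b-min to b′-min; a<b to a′<b′; u to u′; result to result′)
    open CoverAnatomy e public
    open Greedy x y using (X; Y; Unfinished)

    Z : Fin n → Fin n
    Z = pt z

    Y⇒Z : ∀ {i j} → Y i ≡ Y j → Z i ≡ Z j
    Y⇒Z {i} {j} eq = trans (sym (same-block y≼z i)) (trans (cong Z eq) (same-block y≼z j))

    Y-pt : ∀ {c} → Z c ≡ c → Y c ≡ c
    Y-pt {c} Zc≡c = trans (cong Y (sym Zc≡c)) (trans (keeps-point y≼z c) Zc≡c)

    Y⇒Z-pt : ∀ {j c} → Y j ≡ c → Z c ≡ c → Z j ≡ c
    Y⇒Z-pt {j} Yj≡c Zc≡c = trans (sym (same-block y≼z j)) (trans (cong Z Yj≡c) Zc≡c)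

    Y-avoids : ∀ {j c} → Z j ≢ c → Z c ≡ c → Y j ≢ c
    Y-avoids Zj≢c Zc≡c Yj≡c = Zj≢c (Y⇒Z-pt Yj≡c Zc≡c)

    Za′ : Z a′ ≡ p′
    Za′ = proj₁ a′-min
    Zb′ : Z b′ ≡ q′
    Zb′ = proj₁ b′-min
    Xa′ : X a′ ≡ merged
    Xa′ = from-p Za′

    merged-true : u′ ≡ true → merged ≡ p′
    merged-true refl = refl
    merged-false : u′ ≡ false → merged ≡ q′
    merged-false refl = refl

    a′-blockMin-x : BlockMin X a′
    a′-blockMin-x j eq with to-merged j (trans eq Xa′)
    ... | inj₁ Zj≡p′ = proj₂ a′-min j Zj≡p′
    ... | inj₂ Zj≡q′ = ℕ.<⇒≤ (ℕ.<-≤-trans a′<b′ (proj₂ b′-min j Zj≡q′))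

    b′-blockMin-y : BlockMin Y b′
    b′-blockMin-y j eq = proj₂ b′-min j (trans (Y⇒Z eq) Zb′)

    a′-unfinished : Unfinished a′
    a′-unfinished with u′ in eq
    ... | true  = a′-blockMin-x , b′ , trans (from-q Zb′) (sym Xa′) ,
      λ Yb′≡Xb′ → Y-avoids (λ Zb′≡p′ → p′≢q′ (trans (sym Zb′≡p′) Zb′)) p′-pt
                            (trans Yb′≡Xb′ (trans (from-q Zb′) (merged-true eq)))
    ... | false = a′-blockMin-x , a′ , refl ,
      λ Ya′≡Xa′ → Y-avoids (λ Za′≡q′ → p′≢q′ (trans (sym Za′) Za′≡q′)) q′-pt
                            (trans Ya′≡Xa′ (trans Xa′ (merged-false eq)))

  unfinished-above : ∀ {z x} (e : Cover z x) {y m′} → Greedy.Unfinished z y m′ →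
    pt x m′ ≢ CoverAnatomy.merged e → Greedy.Unfinished x y m′
  unfinished-above {z} {x} e {y} {m′} (m′-min , j , Zj≡Zm′ , Yj≢Zj) Xm′≢merged =
    (λ i Xi≡Xm′ → m′-min i (trans (sym (X≡Z Xi≡Xm′)) (trans Xi≡Xm′ (X≡Z refl)))) ,
    j , Xj≡Xm′ , λ Yj≡Xj → Yj≢Zj (trans Yj≡Xj (X≡Z Xj≡Xm′))
    where
    open CoverAnatomy e
    X≡Z : ∀ {i} → pt x i ≡ pt x m′ → pt x i ≡ pt z i
    X≡Z {i} eq = not-merged i (λ Xi≡merged → Xm′≢merged (trans (sym eq) Xi≡merged))
    Xj≡Xm′ : pt x j ≡ pt x m′
    Xj≡Xm′ = pt-cong Zj≡Zm′

  unfinished-below : ∀ {z x} (e : Cover z x) {y m} → Greedy.Unfinished x y m →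
    pt x m ≢ CoverAnatomy.merged e → Greedy.Unfinished z y m
  unfinished-below {z} {x} e {y} {m} (m-min , j , Xj≡Xm , Yj≢Xj) Xm≢merged =
    (λ i Zi≡Zm → m-min i (pt-cong Zi≡Zm)) ,
    j , trans (sym (X≡Z Xj≡Xm)) (trans Xj≡Xm (X≡Z refl)) , λ Yj≡Zj → Yj≢Xj (trans Yj≡Zj (sym (X≡Z Xj≡Xm)))
    where
    open CoverAnatomy e
    X≡Z : ∀ {i} → pt x i ≡ pt x m → pt x i ≡ pt z i
    X≡Z {i} eq = not-merged i (λ Xi≡merged → Xm≢merged (trans (sym eq) Xi≡merged))

  -- what an increasing dual chain starting with e tells about the greedy step after e
  DescendsAfter : ∀ {z x} → Cover z x → PP → Set
  DescendsAfter {z} e y =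
    (∀ i → ¬ Greedy.Unfinished z y i) ⊎
    Σ (y ≼ z) λ r → Σ (Greedy.SplitSite z y) λ s → Greedy.Splitting.splitLabel z y r s <Λ λ• e

  splitLabel-fst : ∀ {x y} (r : y ≼ x) (s : Greedy.SplitSite x y) →
    Λ.fst (Greedy.Splitting.splitLabel x y r s) ≡ Greedy.SplitSite.m s
  splitLabel-fst r (Greedy.site _ _ _ (Greedy.detach _))       = refl
  splitLabel-fst r (Greedy.site _ _ _ (Greedy.halve _ _ _ _)) = refl

  module _ {x y : PP} (r : y ≼ x) where
    open Greedy x y
    open Splitting r

    module OtherCover {z′ : PP} (e′ : Cover z′ x) (y≼z′ : y ≼ z′) (m : Fin n)
                 (m-greatest : ∀ i → Unfinished i → i F.≤ m) where
      open CoverAbove e′ y y≼z′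

      a′≤m : a′ F.≤ m
      a′≤m = m-greatest a′ a′-unfinished

      module SameSite (a′≡m : a′ ≡ m) where
        Zm : Z m ≡ p′
        Zm = trans (cong Z (sym a′≡m)) Za′
        Xm : X m ≡ merged
        Xm = trans (cong X (sym a′≡m)) Xa′

        detachable : u′ ≡ true → ∀ c → BlockMin Y c → Z c ≡ q′ → Detachable m c
        detachable eq c c-min Zc≡q′ =
          c-min , trans (from-q Zc≡q′) (sym Xm) ,
          (λ Yc≡Ym → p′≢q′ (trans (sym Zm) (trans (sym (Y⇒Z Yc≡Ym)) Zc≡q′))) ,
          (λ Yc≡Xm → Y-avoids (λ Zc≡p′ → p′≢q′ (trans (sym Zc≡p′) Zc≡q′)) p′-pt
                              (trans Yc≡Xm (trans Xm (merged-true eq))))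

      detach-greatest : ∀ m-min b b-det → (∀ j → Detachable m j → j F.≤ b) →
        let open Detach m m-min b b-det in
        λ• e′ <Λ λ• cover ⊎ (z′ ≡ z × λ• e′ ≡ λ• cover)
      detach-greatest m-min b b-det b-greatest with a′ F.≟ m
      ... | no a′≢m = inj₁ (diff-a (F.≤∧≢⇒< a′≤m a′≢m))
      ... | yes a′≡m with u′ in eq
      ...   | false = inj₁ (<Λ-A<C refl refl a′≡m)
      ...   | true with b′ F.≟ b
      ...     | no b′≢b =
        inj₁ (<Λ-in-C refl refl a′≡m (F.≤∧≢⇒< (b-greatest b′ (detachable eq b′ b′-blockMin-y Zb′)) b′≢b))
        where open SameSite a′≡m
      ...     | yes b′≡b = inj₂ (pt-ext z′ D.z agree , Λ-≡ a′≡m b′≡b refl)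
        where
        open SameSite a′≡m
        module D = Detach m m-min b b-det

        only-b : ∀ c → BlockMin Y c → Z c ≡ q′ → c ≡ b
        only-b c c-min Zc≡q′ =
          F.≤-antisym (b-greatest c (detachable eq c c-min Zc≡q′))
                      (subst (F._≤ c) b′≡b (proj₂ b′-min c Zc≡q′))

        Yb≡q′ : Y b ≡ q′
        Yb≡q′ with blockMinOf Y q′
        ... | c , Yc≡Yq′ , c-min with only-b c c-min (trans (Y⇒Z Yc≡Yq′) q′-pt)
        ...   | refl = trans Yc≡Yq′ (Y-pt q′-pt)

        agree : ∀ j → Z j ≡ D.Z j
        agree j with D.Z-cases j
        ... | inj₁ (Yj≡Yb , ZDj≡Yb) =
          trans (Y⇒Z-pt (trans Yj≡Yb Yb≡q′) q′-pt) (sym (trans ZDj≡Yb Yb≡q′))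
        ... | inj₂ (Yj≢Yb , ZDj≡Xj) with fate j
        ...   | in-p Zj≡p′ Xj≡merged = trans Zj≡p′ (sym (trans ZDj≡Xj (trans Xj≡merged (merged-true eq))))
        ...   | elsewhere _ _ Xj≡Zj = sym (trans ZDj≡Xj Xj≡Zj)
        ...   | in-q _ Zj≡q′ _ with blockMinOf Y j
        ...     | c , Yc≡Yj , c-min =
          ⊥-elim (Yj≢Yb (trans (sym Yc≡Yj) (cong Y (only-b c c-min (trans (Y⇒Z Yc≡Yj) Zj≡q′)))))

      halve-greatest : ∀ m-min m-witness none β Yβ≡Xm β-min →
        let open Halve m m-min m-witness none β Yβ≡Xm β-min in
        λ• e′ <Λ λ• cover ⊎ (z′ ≡ z × λ• e′ ≡ λ• cover)
      halve-greatest m-min m-witness none β Yβ≡Xm β-min with a′ F.≟ m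
      ... | no a′≢m = inj₁ (diff-a (F.≤∧≢⇒< a′≤m a′≢m))
      ... | yes a′≡m with u′ in eq
      ...   | true = ⊥-elim (none b′ (detachable eq b′ b′-blockMin-y Zb′))
        where open SameSite a′≡m
      ...   | false = inj₂ (pt-ext z′ H.z agree , Λ-≡ a′≡m b′≡β refl)
        where
        open SameSite a′≡m
        module H = Halve m m-min m-witness none β Yβ≡Xm β-min

        Xm≡q′ : X m ≡ q′
        Xm≡q′ = trans Xm (merged-false eq)

        p′≡Ym : p′ ≡ Y m
        p′≡Ym with H.two-blocks p′ (trans (from-p p′-pt) (sym Xm))
        ... | inj₁ Yp′≡Ym = trans (sym (Y-pt p′-pt)) Yp′≡Ym
        ... | inj₂ Yp′≡Xm = ⊥-elim (p′≢q′ (trans (sym (Y-pt p′-pt)) (trans Yp′≡Xm Xm≡q′)))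

        agree : ∀ j → Z j ≡ H.Z j
        agree j with H.Z-cases j
        ... | inj₂ (Xj≢Xm , ZHj≡Xj) = sym (trans ZHj≡Xj (not-merged j (λ eq → Xj≢Xm (trans eq (sym Xm)))))
        ... | inj₁ (Xj≡Xm , ZHj≡Yj) with H.two-blocks j Xj≡Xm
        ...   | inj₁ Yj≡Ym = trans (Y⇒Z Yj≡Ym) (trans Zm (trans p′≡Ym (sym (trans ZHj≡Yj Yj≡Ym))))
        ...   | inj₂ Yj≡Xm = trans (Y⇒Z-pt (trans Yj≡Xm Xm≡q′) q′-pt) (sym (trans ZHj≡Yj (trans Yj≡Xm Xm≡q′)))

        b′≡β : b′ ≡ β
        b′≡β = F.≤-antisym (proj₂ b′-min β (Y⇒Z-pt (trans Yβ≡Xm Xm≡q′) q′-pt)) (β-min b′ Yb′≡Yβ)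
          where
          Yb′≡Yβ : Y b′ ≡ Y β
          Yb′≡Yβ with H.two-blocks b′ (trans (from-q Zb′) (sym Xm))
          ... | inj₁ Yb′≡Ym = ⊥-elim (p′≢q′ (trans (sym Zm) (trans (sym (Y⇒Z Yb′≡Ym)) Zb′)))
          ... | inj₂ Yb′≡Xm = trans Yb′≡Xm (sym Yβ≡Xm)

    splitLabel-greatest : (s : SplitSite) → ∀ {z′} (e′ : Cover z′ x) → y ≼ z′ →
      λ• e′ <Λ splitLabel s ⊎ (z′ ≡ Split.z (split s) × λ• e′ ≡ splitLabel s)
    splitLabel-greatest (site m (m-min , _) m-greatest (detach (b , b-det , b-greatest))) e′ y≼z′ =
      OtherCover.detach-greatest e′ y≼z′ m m-greatest m-min b b-det b-greatest
    splitLabel-greatest (site m (m-min , m-witness) m-greatest (halve none β Yβ≡Xm β-min)) e′ y≼z′ =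
      OtherCover.halve-greatest e′ y≼z′ m m-greatest m-min m-witness none β Yβ≡Xm β-min

    module NextSplit (m : Fin n) (m-min : BlockMin X m) (m-greatest : ∀ i → Unfinished i → i F.≤ m) where
      earlier : ∀ {z} (e : Cover z x) → CoverAnatomy.merged e ≡ X m →
        ∀ {m′} → Greedy.Unfinished z y m′ → X m′ ≢ X m → m′ F.< m
      earlier e merged≡Xm m′-unf Xm′≢Xm =
        F.≤∧≢⇒< (m-greatest _ (unfinished-above e {y} m′-unf (λ eq → Xm′≢Xm (trans eq merged≡Xm))))
                (λ eq → Xm′≢Xm (cong X eq))

      detach-decreasing : ∀ b b-det → (∀ j → Detachable m j → j F.≤ b) →
        let open Detach m m-min b b-det in
        ∀ (r′ : y ≼ z) s′ → Greedy.Splitting.splitLabel z y r′ s′ <Λ λ• cover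
      detach-decreasing b b-det b-greatest r′
                        s′@(Greedy.site m′ m′-unf@(m′-min , j , Zj≡Zm′ , Yj≢Zj) m′-greatest kind′)
        with X m′ F.≟ X m
      ... | no Xm′≢Xm =
        diff-a (subst (F._< m) (sym (splitLabel-fst r′ s′)) (earlier D.cover refl m′-unf Xm′≢Xm))
        where module D = Detach m m-min b b-det
      ... | yes Xm′≡Xm = same-site kind′
        where
        open Detach m m-min b b-det

        Zm′≡p : Z m′ ≡ p
        Zm′≡p = trans (Z-out m′ (unsplit-misses-q Zj≡Zm′ Yj≢Zj)) Xm′≡Xm

        m′≡m : m′ ≡ m
        m′≡m = F.≤-antisym (m′-min m (trans (proj₁ m-blockMin) (sym Zm′≡p))) (m-min m′ Xm′≡Xm)

        same-site : (kind′ : Greedy.SplitKind z y m′) →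
          Greedy.Splitting.splitLabel z y r′ (Greedy.site m′ m′-unf m′-greatest kind′) <Λ λ• cover
        same-site (Greedy.halve _ _ _ _) = <Λ-A<C refl refl m′≡m
        same-site (Greedy.detach (b″ , (b″-min , Zb″≡Zm′ , Yb″≢Ym′ , Yb″≢Zm′) , _)) =
          <Λ-in-C refl refl m′≡m (F.≤∧≢⇒< (b-greatest b″ b″-det) (λ eq → Yb″≢q (cong Y eq)))
          where
          Zb″≡p : Z b″ ≡ p
          Zb″≡p = trans Zb″≡Zm′ Zm′≡p
          Yb″≢q : Y b″ ≢ q
          Yb″≢q eq = q≢p (trans (sym (Z-in b″ eq)) Zb″≡p)
          b″-det : Detachable m b″
          b″-det = b″-min , trans (sym (Z-out b″ Yb″≢q)) Zb″≡p ,
                   (λ eq → Yb″≢Ym′ (trans eq (cong Y (sym m′≡m)))) ,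
                   (λ eq → Yb″≢Zm′ (trans eq (sym Zm′≡p)))

      halve-decreasing : ∀ m-witness none β Yβ≡Xm β-min →
        let open Halve m m-min m-witness none β Yβ≡Xm β-min in
        ∀ (r′ : y ≼ z) s′ → Greedy.Splitting.splitLabel z y r′ s′ <Λ λ• cover
      halve-decreasing m-witness none β Yβ≡Xm β-min r′ s′@(Greedy.site m′ m′-unf@(_ , j , Zj≡Zm′ , Yj≢Zj) _ _) =
        diff-a (subst (F._< m) (sym (splitLabel-fst r′ s′))
                      (earlier H.cover refl m′-unf (H.unsplit-outside Zj≡Zm′ Yj≢Zj)))
        where module H = Halve m m-min m-witness none β Yβ≡Xm β-min

    splitLabel-decreasing : (s : SplitSite) → let open Split (split s) in
      ∀ (r′ : y ≼ z) s′ → Greedy.Splitting.splitLabel z y r′ s′ <Λ splitLabel s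
    splitLabel-decreasing (site m (m-min , _) m-greatest (detach (b , b-det , b-greatest))) =
      NextSplit.detach-decreasing m m-min m-greatest b b-det b-greatest
    splitLabel-decreasing (site m (m-min , m-witness) m-greatest (halve none β Yβ≡Xm β-min)) =
      NextSplit.halve-decreasing m m-min m-greatest m-witness none β Yβ≡Xm β-min

    module Detour (m : Fin n) (m-unfinished : Unfinished m) (m-greatest : ∀ i → Unfinished i → i F.≤ m)
                  {z′ : PP} (e′ : Cover z′ x) (y≼z′ : y ≼ z′) (after : DescendsAfter e′ y) where
      open CoverAbove e′ y y≼z′
      open Greedy z′ y using () renaming (Unfinished to Unfinished′; SplitSite to SplitSite′)
      open Greedy.SplitSite using (greatest) renaming (m to m-of)

      m-min : BlockMin X m
      m-min = proj₁ m-unfinished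

      site-≤ : (r′ : y ≼ z′) (s′ : SplitSite′) →
        Greedy.Splitting.splitLabel z′ y r′ s′ <Λ λ• e′ → m-of s′ F.≤ a′
      site-≤ r′ s′ lt′ = subst (F._≤ a′) (splitLabel-fst r′ s′) (<Λ-fst lt′)

      bounded : ∀ i → Unfinished′ i → i F.≤ a′
      bounded i ui = [ (λ none → ⊥-elim (none i ui)) ,
                       (λ (r′ , s′ , lt′) → F.≤-trans (greatest s′ i ui) (site-≤ r′ s′ lt′)) ]′ after

      Resplit : Set
      Resplit = Σ (y ≼ z′) λ r′ → Σ SplitSite′ λ s′ →
        m-of s′ ≡ a′ × Greedy.Splitting.splitLabel z′ y r′ s′ <Λ λ• e′

      resplit : Unfinished′ a′ → Resplit
      resplit ua′ =
        [ (λ none → ⊥-elim (none a′ ua′)) ,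
          (λ (r′ , s′ , lt′) → r′ , s′ , F.≤-antisym (site-≤ r′ s′ lt′) (greatest s′ a′ ua′) , lt′) ]′ after

      a′≡m : a′ ≡ m
      a′≡m with a′ F.≟ m
      ... | yes a′≡m = a′≡m
      ... | no a′≢m  =
        ⊥-elim (a′≢m (F.≤-antisym a′≤m (bounded m (unfinished-below e′ {y} m-unfinished Xm≢merged))))
        where
        a′≤m : a′ F.≤ m
        a′≤m = m-greatest a′ a′-unfinished
        Xm≢merged : X m ≢ merged
        Xm≢merged eq = a′≢m (F.≤-antisym a′≤m (m-min a′ (trans Xa′ (sym eq))))

      Zm≡p′ : Z m ≡ p′
      Zm≡p′ = trans (cong Z (sym a′≡m)) Za′
      Xm≡merged : X m ≡ merged
      Xm≡merged = trans (cong X (sym a′≡m)) Xa′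

      a′-unfinished′ : ∀ j → Z j ≡ p′ → Y j ≢ p′ → Unfinished′ a′
      a′-unfinished′ j Zj≡p′ Yj≢p′ =
        (λ k eq → proj₂ a′-min k (trans eq Za′)) , j , trans Zj≡p′ (sym Za′) , λ eq → Yj≢p′ (trans eq Zj≡p′)

      b′-finished : ∀ j → Z j ≡ q′ → Y j ≢ q′ → ⊥
      b′-finished j Zj≡q′ Yj≢q′ = ℕ.<⇒≱ a′<b′ (bounded b′ b′-unfinished′)
        where
        b′-unfinished′ : Unfinished′ b′
        b′-unfinished′ = (λ k eq → proj₂ b′-min k (trans eq Zb′)) , j , trans Zj≡q′ (sym Zb′) ,
                         λ eq → Yj≢q′ (trans eq Zj≡q′)

      halve-refuted : ∀ {β h} → ¬ (λ• e′ <Λ (⟨ m , β ⟩^ false [ h ]))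
      halve-refuted lt with proj₁ (<Λ-same-fst lt a′≡m)
      ... | ()

      ¬resplit-after-0-merge : u′ ≡ false → ¬ Resplit
      ¬resplit-after-0-merge u′≡false (r′ , s′ , m′≡a′ , lt′)
        with trans (sym u′≡false) (proj₁ (<Λ-same-fst lt′ (trans (splitLabel-fst r′ s′) m′≡a′)))
      ... | ()

      ¬resplit-with-later-detachable : ∀ {b} → BlockMin Y b → Z b ≡ p′ → Y b ≢ Y m → Y b ≢ p′ → b′ F.< b →
        ¬ Resplit
      ¬resplit-with-later-detachable {b} b-min Zb≡p′ Yb≢Ym Yb≢p′ b′<b
                                     (r′ , Greedy.site m″ _ _ kind″ , m″≡a′ , lt′) = refute kind″ lt′
        where
        m″≡m : m″ ≡ m
        m″≡m = trans m″≡a′ a′≡m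
        Zm″≡p′ : Z m″ ≡ p′
        Zm″≡p′ = trans (cong Z m″≡m) Zm≡p′
        b-detachable″ : Greedy.Detachable z′ y m″ b
        b-detachable″ = b-min , trans Zb≡p′ (sym Zm″≡p′) , (λ eq → Yb≢Ym (trans eq (cong Y m″≡m))) ,
                        (λ eq → Yb≢p′ (trans eq Zm″≡p′))
        refute : ∀ {u″ g″} (kind″ : Greedy.SplitKind z′ y m″) →
          ¬ (Greedy.Splitting.splitLabel z′ y r′ (Greedy.site m″ u″ g″ kind″) <Λ λ• e′)
        refute (Greedy.halve none″ _ _ _) _ = none″ b b-detachable″
        refute (Greedy.detach (b‴ , _ , b‴-greatest)) lt′ with proj₂ (<Λ-same-fst lt′ m″≡a′)
        ... | inj₂ (_ , b‴<b′) = ℕ.<⇒≱ (F.<-trans b‴<b′ b′<b) (b‴-greatest b b-detachable″)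

      detach-refuted : ∀ b {h} → Detachable m b → ¬ (λ• e′ <Λ (⟨ m , b ⟩^ true [ h ]))
      detach-refuted b (b-min , Xb≡Xm , Yb≢Ym , Yb≢Xm) lt
        with proj₂ (<Λ-same-fst lt a′≡m) | to-merged b (trans Xb≡Xm Xm≡merged)
      ... | inj₁ u′≡false | inj₂ Zb≡q′ =
        b′-finished b Zb≡q′ λ Yb≡q′ → Yb≢Xm (trans Yb≡q′ (sym (trans Xm≡merged (merged-false u′≡false))))
      ... | inj₁ u′≡false | inj₁ Zb≡p′ with Y b F.≟ p′
      ...   | no Yb≢p′  = ¬resplit-after-0-merge u′≡false (resplit (a′-unfinished′ b Zb≡p′ Yb≢p′))
      ...   | yes Yb≡p′ = ¬resplit-after-0-merge u′≡false
                            (resplit (a′-unfinished′ m Zm≡p′ λ Ym≡p′ → Yb≢Ym (trans Yb≡p′ (sym Ym≡p′))))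
      detach-refuted b (b-min , _ , _ , _) _ | inj₂ (_ , b′<b) | inj₂ Zb≡q′ with Y b F.≟ q′
      ... | no Yb≢q′  = b′-finished b Zb≡q′ Yb≢q′
      ... | yes Yb≡q′ = b′-finished b′ Zb′ λ Yb′≡q′ → ℕ.<⇒≱ b′<b (b-min b′ (trans Yb′≡q′ (sym Yb≡q′)))
      detach-refuted b (b-min , _ , Yb≢Ym , Yb≢Xm) _ | inj₂ (u′≡true , b′<b) | inj₁ Zb≡p′ =
        ¬resplit-with-later-detachable b-min Zb≡p′ Yb≢Ym Yb≢p′ b′<b (resplit (a′-unfinished′ b Zb≡p′ Yb≢p′))
        where
        Yb≢p′ : Y b ≢ p′
        Yb≢p′ Yb≡p′ = Yb≢Xm (trans Yb≡p′ (sym (trans Xm≡merged (merged-true u′≡true))))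

    no-detour : (s : SplitSite) → ∀ {z′} (e′ : Cover z′ x) → y ≼ z′ →
      λ• e′ <Λ splitLabel s → ¬ DescendsAfter e′ y
    no-detour (site m m-unfinished m-greatest (halve _ _ _ _)) e′ y≼z′ lt after =
      Detour.halve-refuted m m-unfinished m-greatest e′ y≼z′ after lt
    no-detour (site m m-unfinished m-greatest (detach (b , b-det , _))) e′ y≼z′ lt after =
      Detour.detach-refuted m m-unfinished m-greatest e′ y≼z′ after b b-det lt

  mismatches : PP → PP → Subset n
  mismatches x y = tabulate λ i → not ⌊ pt x i F.≟ pt y i ⌋

  ∈-mismatches⁺ : ∀ {x y i} → pt x i ≢ pt y i → i Subset.∈ mismatches x y
  ∈-mismatches⁺ {x} {y} {i} Xi≢Yi = lookup⇒[]= i _ (trans (lookup∘tabulate _ i) differs)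
    where
    differs : not ⌊ pt x i F.≟ pt y i ⌋ ≡ true
    differs with pt x i F.≟ pt y i
    ... | yes Xi≡Yi = ⊥-elim (Xi≢Yi Xi≡Yi)
    ... | no _      = refl

  ∈-mismatches⁻ : ∀ {x y i} → i Subset.∈ mismatches x y → pt x i ≢ pt y i
  ∈-mismatches⁻ {x} {y} {i} i∈ Xi≡Yi = differs (trans (sym (lookup∘tabulate _ i)) ([]=⇒lookup i∈))
    where
    differs : not ⌊ pt x i F.≟ pt y i ⌋ ≢ true
    differs with pt x i F.≟ pt y i
    ... | yes _     = λ ()
    ... | no Xi≢Yi  = ⊥-elim (Xi≢Yi Xi≡Yi)

  ≼-between : ∀ {x y z} → y ≼ z → z ≼ x → ∀ {i} → pt x i ≡ pt y i → pt z i ≡ pt y i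
  ≼-between {x} {y} {z} y≼z z≼x {i} Xi≡Yi = begin
    pt z i          ≡⟨ same-block y≼z i ⟨
    pt z (pt y i)   ≡⟨ cong (pt z) Xi≡Yi ⟨
    pt z (pt x i)   ≡⟨ keeps-point z≼x i ⟩
    pt x i          ≡⟨ Xi≡Yi ⟩
    pt y i          ∎
    where open ≡-Reasoning

  split-shrinks-mismatches : ∀ {x y} (r : y ≼ x) (s : Greedy.SplitSite x y) →
    let open Greedy.Splitting x y r in mismatches (Split.z (split s)) y ⊂ mismatches x y
  split-shrinks-mismatches {x} {y} r s =
    (λ i∈ → ∈-mismatches⁺ {x} {y} λ Xi≡Yi →
              ∈-mismatches⁻ {z} {y} i∈ (≼-between refines (cover⇒≼ cover) Xi≡Yi)) ,
    i , ∈-mismatches⁺ {x} {y} Xi≢Yi , λ i∈ → ∈-mismatches⁻ {z} {y} i∈ Zi≡Yi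
    where
    open Greedy.Splitting x y r
    open Split (split s)
    i = proj₁ progress
    Xi≢Yi = proj₁ (proj₂ progress)
    Zi≡Yi = proj₂ (proj₂ progress)

module _ {n : ℕ} where
  open Dual (Cover {n}) λ• (_<Λ_ {n})
  open GreedyEL _⋖*_ label* _<L*_ (λ x y → y ≼ x)

  differing : ∀ {x y : PointedPartition n} → x ≢ y → Σ (Fin n) λ j → pt y j ≢ pt x j
  differing {x} {y} x≢y = F.¬∀⟶∃¬ n _ (λ j → pt y j F.≟ pt x j) λ same → x≢y (sym (pt-ext y x same))

  greedySite : ∀ {x y : PointedPartition n} → y ≼ x → x ≢ y → Greedy.SplitSite x y
  greedySite r x≢y = Greedy.splitSite _ _ r (differing x≢y)

  greedyDescent : GreedyDescent
  greedyDescent = record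
    { _≟_      = _≟PP_
    ; ⊑-refl   = ≼-refl
    ; ⊑-trans  = λ y≼x z≼y → ≼-trans z≼y y≼x
    ; ⋖⇒⊑      = cover⇒≼
    ; ⋖-⊑-asym = cover-≽-absurd
    ; size     = λ x y → ∣ mismatches x y ∣
    ; step     = λ {x} {y} r x≢y → let open Greedy.Splitting x y r; s = greedySite r x≢y in record
        { edge = Split.cover (split s) ; towards = Split.refines (split s)
        ; smaller = p⊂q⇒∣p∣<∣q∣ (split-shrinks-mismatches r s) }
    ; step-least      = λ r x≢y → splitLabel-greatest r (greedySite r x≢y)
    ; step-increasing = λ r x≢y r′ z≢y → splitLabel-decreasing r (greedySite r x≢y) r′ (greedySite r′ z≢y)
    ; step-no-detour  = λ r x≢y e z⊑y lt continuation →
        no-detour r (greedySite r x≢y) e z⊑y lt (descends {e = e} continuation)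
    }
    where
    descends : ∀ {z x y} {e : Cover z x} → z ≡ y ⊎ Σ (y ≼ z) (λ r′ → Σ (z ≢ y) λ z≢y →
      Greedy.Splitting.splitLabel z y r′ (greedySite r′ z≢y) <Λ λ• e) → DescendsAfter e y
    descends (inj₁ refl)              = inj₁ λ _ (_ , _ , _ , Yj≢Zj) → Yj≢Zj refl
    descends (inj₂ (r′ , z≢y , lt′)) = inj₂ (r′ , greedySite r′ z≢y , lt′)

  dual-λ•-isELLabeling : IsDualELLabeling
  dual-λ•-isELLabeling = isELLabeling greedyDescent

-- the argument needs no lower bound on n
theorem2p15 : (n : ℕ) → 1 ≤ n →
    Dual.IsDualELLabeling (Cover {n}) λ• (_<Λ_ {n})
theorem2p15 n _ = dual-λ•-isELLabeling
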